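{- Let $g,v$ be positive integers, let $q$ be a prime, and let $m=q^2+q+1$. Let $a_0,a_1,\dots,a_q$ be integers in $[m]$ such that the $q^2+q$ differences $a_i-a_j$ with $i\ne j$ are congruent modulo $m$ to the numbers $1,2,\dots,q^2+q$ in some order. If $\mathcal{B}=\{b_1,b_2,\dots,b_{\eta_g(v)}\}$ is a $g$-difference basis for $[v]$, then the set $\mathcal{F}=\{a_i+mb_j : 0\le i\le q,\ 1\le j\le \eta_g(v)\}$ is a $g$-difference basis for $[mv]$.
   Context: For a positive integer $n$ write $[n]=\{1,\dots,n\}$. A set $A\subseteq\mathbb{Z}$ is a $g$-difference basis for $[n]$ if for every $x\in[n]$ there are at least $g$ pairs $(a_1,a_2)\in A\times A$ with $a_1-a_2=x$. $\eta_g(v)$ denotes the minimum size of a $g$-difference basis for $[v]$. (Integers $a_0,\dots,a_q$ as in the claim exist by Singer's theorem; the paper assumes they are taken in $[m]$.) -}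

module Defs where

open import Data.Nat using (ℕ; suc; _≤_; _*_; _+_)
open import Data.Integer as ℤ using (ℤ; +_; _-_)
open import Data.List using (List; length; filter; cartesianProduct; deduplicate; concatMap; map; allFin)
open import Data.List.Relation.Unary.Unique.Propositional using (Unique)
open import Data.Product using (_×_; proj₁; proj₂; _,_)
open import Data.Fin using (Fin)

-- A finite set of integers is represented by a duplicate-free list.
-- Number of ordered pairs (a₁ , a₂) ∈ A × A with a₁ - a₂ = x.
pairCount : List ℤ → ℤ → ℕ
pairCount A x = length (filter (λ p → (proj₁ p - proj₂ p) ℤ.≟ x) (cartesianProduct A A))

IsDiffBasis : ℕ → ℕ → List ℤ → Set
IsDiffBasis g n A = Unique A × (∀ (x : ℕ) → 1 ≤ x → x ≤ n → g ≤ pairCount A (+ x))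

IsMinDiffBasis : ℕ → ℕ → List ℤ → Set
IsMinDiffBasis g n B =
  IsDiffBasis g n B × (∀ (A : List ℤ) → IsDiffBasis g n A → length B ≤ length A)

sumSet : ∀ {q : ℕ} → ℕ → (Fin (suc q) → ℤ) → List ℤ → List ℤ
sumSet {q} m a B =
  deduplicate ℤ._≟_ (concatMap (λ i → map (λ b → a i ℤ.+ (+ m) ℤ.* b) B) (allFin (suc q)))

-- Write x ∈ [1, m v] as x = r + t m with 0 ≤ r < m. The difference property
-- gives indices i, j with a_i - a_j = r or a_i - a_j = r - m (for r = 0 take
-- i = j), so x = (a_i - a_j) + m d with d = t or d = t + 1, and in both cases
-- 0 ≤ d ≤ v. Every pair (b, c) of B with b - c = d yields the pair
-- (a_i + m b, a_j + m c) of F with difference x, and distinct pairs of B yield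
-- distinct pairs of F. For d = 0 the diagonal pairs (b, b) give at least |B|
-- representations, and |B| ≥ g since already the difference 1 is represented
-- g times.
module Submission where

open import Defs
open import Data.Nat using (ℕ; suc; _≤_; _*_; _+_)
open import Data.Nat.Primality using (Prime)
open import Data.Integer as ℤ using (ℤ; +_; _-_)
open import Data.Integer.Divisibility using (_∣_)
open import Data.Fin using (Fin; toℕ)
open import Data.Product using (Σ; _×_; _,_; proj₁; proj₂)
open import Relation.Binary.PropositionalEquality using (_≢_)
open import Function.Bundles using (_⤖_; Bijection)
open import Data.List using (List)

open import Data.Nat using (zero; _∸_; _<_; z≤n; s≤s; NonZero; >-nonZero)
open import Data.Nat.Properties as ℕP using (module ≤-Reasoning)
import Data.Nat.Divisibility as ℕ
open import Data.Nat.DivMod using (_/_; _%_; m≡m%n+[m/n]*n; m%n<n)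
open import Data.Integer using (_⊖_)
import Data.Integer.Properties as ℤP
import Data.Integer.Tactic.RingSolver as ℤ-Solver
open import Algebra.Bundles using (AbelianGroup)
open import Algebra.Properties.Group (AbelianGroup.group ℤP.+-0-abelianGroup)
  using () renaming (∙-cancelˡ to +-cancelˡ)
open import Data.Fin as Fin using (fromℕ<)
open import Data.Fin.Properties using (toℕ-fromℕ<)
open import Data.List using ([]; _∷_; length; map; filter; cartesianProduct)
open import Data.List.Properties using (length-map; length-removeAt′)
open import Data.List.Membership.Propositional using (_∈_; lose)
open import Data.List.Membership.Propositional.Properties
open import Data.List.Relation.Binary.Subset.Propositional using (_⊆_)
open import Data.List.Relation.Unary.Any using (here; there; index; _─_)
import Data.List.Relation.Unary.All as All
open import Data.List.Relation.Unary.Unique.Propositional using (Unique; []; _∷_)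
import Data.List.Relation.Unary.Unique.Propositional.Properties as Unique
import Data.List.Relation.Unary.Unique.DecPropositional.Properties as UniqueDec
open import Data.Product using (∃; ∃₂)
open import Data.Sum as Sum using (_⊎_; inj₁; inj₂)
open import Data.Empty using (⊥-elim)
open import Relation.Nullary using (yes; no; contradiction)
open import Relation.Binary.PropositionalEquality
  using (_≡_; refl; sym; trans; cong; cong₂; subst; module ≡-Reasoning)

∈-─ : ∀ {A : Set} {x z : A} {ys : List A} (x∈ys : x ∈ ys) → z ∈ ys → z ≢ x → z ∈ (ys ─ x∈ys)
∈-─ (here refl) (here refl) z≢x = ⊥-elim (z≢x refl)
∈-─ (here refl) (there z∈ys) _ = z∈ys
∈-─ (there x∈ys) (here refl) _ = here refl
∈-─ (there x∈ys) (there z∈ys) z≢x = there (∈-─ x∈ys z∈ys z≢x)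

Unique⇒length≤ : ∀ {A : Set} {xs ys : List A} → Unique xs → xs ⊆ ys → length xs ≤ length ys
Unique⇒length≤ {xs = []} [] _ = z≤n
Unique⇒length≤ {xs = x ∷ xs} {ys} (x∉xs ∷ !xs) xs⊆ys = begin
  suc (length xs)          ≤⟨ s≤s (Unique⇒length≤ !xs xs⊆ys─x) ⟩
  suc (length (ys ─ x∈ys)) ≡⟨ sym (length-removeAt′ ys (index x∈ys)) ⟩
  length ys                ∎
  where
    open ≤-Reasoning
    x∈ys : x ∈ ys
    x∈ys = xs⊆ys (here refl)
    xs⊆ys─x : xs ⊆ (ys ─ x∈ys)
    xs⊆ys─x z∈xs = ∈-─ x∈ys (xs⊆ys (there z∈xs)) (λ z≡x → All.lookup x∉xs z∈xs (sym z≡x))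

pairsWithDiff : List ℤ → ℤ → List (ℤ × ℤ)
pairsWithDiff A x = filter (λ p → (proj₁ p - proj₂ p) ℤ.≟ x) (cartesianProduct A A)

∈-pairsWithDiff⁺ : ∀ {A x b c} → b ∈ A → c ∈ A → b - c ≡ x → (b , c) ∈ pairsWithDiff A x
∈-pairsWithDiff⁺ {x = x} b∈A c∈A b-c≡x =
  ∈-filter⁺ (λ p → (proj₁ p - proj₂ p) ℤ.≟ x) (∈-cartesianProduct⁺ b∈A c∈A) b-c≡x

∈-pairsWithDiff⁻ : ∀ A x {b c} → (b , c) ∈ pairsWithDiff A x → b ∈ A × c ∈ A × b - c ≡ x
∈-pairsWithDiff⁻ A x bc∈ with ∈-filter⁻ (λ p → (proj₁ p - proj₂ p) ℤ.≟ x) bc∈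
... | bc∈A×A , b-c≡x with ∈-cartesianProduct⁻ A A bc∈A×A
...   | b∈A , c∈A = b∈A , c∈A , b-c≡x

pairsWithDiff-unique : ∀ {A} x → Unique A → Unique (pairsWithDiff A x)
pairsWithDiff-unique x !A =
  Unique.filter⁺ (λ p → (proj₁ p - proj₂ p) ℤ.≟ x) (Unique.cartesianProduct⁺ !A !A)

b-[b-c]≡c : ∀ b c → b - (b - c) ≡ c
b-[b-c]≡c = ℤ-Solver.solve-∀

-- A pair with difference x is determined by its first component.
pairCount≤length : ∀ {A} x → Unique A → pairCount A x ≤ length A
pairCount≤length {A} x !A = begin
  pairCount A x          ≤⟨ Unique⇒length≤ (pairsWithDiff-unique x !A) pairs⊆ ⟩
  length (map partner A) ≡⟨ length-map partner A ⟩
  length A               ∎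
  where
    open ≤-Reasoning
    partner : ℤ → ℤ × ℤ
    partner b = b , b - x
    subtrahend : ∀ b c → b - c ≡ x → c ≡ b - x
    subtrahend b c b-c≡x = trans (sym (b-[b-c]≡c b c)) (cong (b -_) b-c≡x)
    pairs⊆ : pairsWithDiff A x ⊆ map partner A
    pairs⊆ {b , c} bc∈ with ∈-pairsWithDiff⁻ A x bc∈
    ... | b∈A , _ , b-c≡x = subst (λ c′ → (b , c′) ∈ map partner A)
                                  (sym (subtrahend b c b-c≡x)) (∈-map⁺ partner b∈A)

length≤pairCount-0 : ∀ {A} → Unique A → length A ≤ pairCount A (+ 0)
length≤pairCount-0 {A} !A = begin
  length A                ≡⟨ length-map diagonal A ⟨
  length (map diagonal A) ≤⟨ Unique⇒length≤ (Unique.map⁺ (cong proj₁) !A) diagonal⊆ ⟩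
  pairCount A (+ 0)       ∎
  where
    open ≤-Reasoning
    diagonal : ℤ → ℤ × ℤ
    diagonal b = b , b
    diagonal⊆ : map diagonal A ⊆ pairsWithDiff A (+ 0)
    diagonal⊆ p∈ with ∈-map⁻ diagonal p∈
    ... | b , b∈A , refl = ∈-pairsWithDiff⁺ b∈A b∈A (ℤP.+-inverseʳ b)

IsDiffBasis⇒pairCount≥ : ∀ {g v B} → IsDiffBasis g v B → 1 ≤ v →
                         ∀ d → d ≤ v → g ≤ pairCount B (+ d)
IsDiffBasis⇒pairCount≥ {g} {B = B} (!B , represented) 1≤v zero _ = begin
  g                 ≤⟨ represented 1 ℕP.≤-refl 1≤v ⟩
  pairCount B (+ 1) ≤⟨ pairCount≤length (+ 1) !B ⟩
  length B          ≤⟨ length≤pairCount-0 !B ⟩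
  pairCount B (+ 0) ∎
  where open ≤-Reasoning
IsDiffBasis⇒pairCount≥ (_ , represented) _ (suc d) d≤v = represented (suc d) (s≤s z≤n) d≤v

∈-sumSet⁺ : ∀ m {q} (a : Fin (suc q) → ℤ) {B b} i → b ∈ B → a i ℤ.+ + m ℤ.* b ∈ sumSet m a B
∈-sumSet⁺ m a {B} i b∈B =
  ∈-deduplicate⁺ ℤ._≟_ (∈-concatMap⁺ (λ k → map (λ b → a k ℤ.+ + m ℤ.* b) B)
    (lose (∈-allFin i) (∈-map⁺ (λ b → a i ℤ.+ + m ℤ.* b) b∈B)))

dilated-difference : ∀ α β m b c →
  (α ℤ.+ m ℤ.* b) - (β ℤ.+ m ℤ.* c) ≡ (α - β) ℤ.+ m ℤ.* (b - c)
dilated-difference = ℤ-Solver.solve-∀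

pairCount-sumSet : ∀ {m q} .{{_ : NonZero m}} (a : Fin (suc q) → ℤ) {B} → Unique B →
  ∀ i j x → pairCount B x ≤ pairCount (sumSet m a B) ((a i - a j) ℤ.+ + m ℤ.* x)
pairCount-sumSet {m} a {B} !B i j x = begin
  pairCount B x                                        ≡⟨ length-map lift (pairsWithDiff B x) ⟨
  length (map lift (pairsWithDiff B x))                ≤⟨ Unique⇒length≤ !lifted lifted⊆ ⟩
  pairCount (sumSet m a B) ((a i - a j) ℤ.+ + m ℤ.* x) ∎
  where
    open ≤-Reasoning
    lift : ℤ × ℤ → ℤ × ℤ
    lift (b , c) = a i ℤ.+ + m ℤ.* b , a j ℤ.+ + m ℤ.* c
    dilate-injective : ∀ α {b c} → α ℤ.+ + m ℤ.* b ≡ α ℤ.+ + m ℤ.* c → b ≡ c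
    dilate-injective α {b} {c} eq = ℤP.*-cancelˡ-≡ (+ m) b c (+-cancelˡ α _ _ eq)
    !lifted : Unique (map lift (pairsWithDiff B x))
    !lifted = Unique.map⁺ (λ eq → cong₂ _,_ (dilate-injective (a i) (cong proj₁ eq))
                                            (dilate-injective (a j) (cong proj₂ eq)))
                          (pairsWithDiff-unique x !B)
    lifted⊆ : map lift (pairsWithDiff B x) ⊆ pairsWithDiff (sumSet m a B) ((a i - a j) ℤ.+ + m ℤ.* x)
    lifted⊆ p∈ with ∈-map⁻ lift p∈
    ... | (b , c) , bc∈ , refl with ∈-pairsWithDiff⁻ B x bc∈
    ...   | b∈B , c∈B , b-c≡x =
      ∈-pairsWithDiff⁺ (∈-sumSet⁺ m a i b∈B) (∈-sumSet⁺ m a j c∈B)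
        (trans (dilated-difference (a i) (a j) (+ m) b c)
               (cong (λ δ → (a i - a j) ℤ.+ + m ℤ.* δ) b-c≡x))

multiple<⇒≡0 : ∀ {m k} → m ℕ.∣ k → k < m → k ≡ 0
multiple<⇒≡0 (ℕ.divides zero k≡0) _ = k≡0
multiple<⇒≡0 {m} (ℕ.divides (suc c) refl) k<m = contradiction k<m (ℕP.≤⇒≯ (ℕP.m≤m+n m (c * m)))

multiple<double⇒≡ : ∀ {m k} → m ℕ.∣ k → 0 < k → k < m + m → k ≡ m
multiple<double⇒≡ (ℕ.divides zero refl) () _
multiple<double⇒≡ {m} (ℕ.divides (suc zero) k≡m+0) _ _ = trans k≡m+0 (ℕP.+-identityʳ m)
multiple<double⇒≡ {m} (ℕ.divides (suc (suc c)) refl) _ k<2m =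
  contradiction k<2m (ℕP.≤⇒≯ (ℕP.+-monoʳ-≤ m (ℕP.m≤m+n m (c * m))))

bounded-⊖-multiple : ∀ {m u w} → + m ∣ u ⊖ w → u ≤ m → 0 < w → w < m + m →
             u ⊖ w ≡ + 0 ⊎ u ⊖ w ≡ ℤ.- + m
bounded-⊖-multiple {m} {u} {w} m∣u⊖w u≤m 0<w w<2m with w ℕP.≤? u
... | yes w≤u = inj₁ (trans (ℤP.⊖-≥ w≤u) (cong +_ (multiple<⇒≡0 m∣u∸w u∸w<m)))
  where
    m∣u∸w : m ℕ.∣ u ∸ w
    m∣u∸w = subst (m ℕ.∣_) (cong ℤ.∣_∣ (ℤP.⊖-≥ w≤u)) m∣u⊖w
    u∸w<m : u ∸ w < m
    u∸w<m = ℕP.<-≤-trans (ℕP.∸-monoʳ-< 0<w w≤u) u≤m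
... | no w≰u = inj₂ (trans (ℤP.⊖-< u<w) (cong (λ k → ℤ.- + k) w∸u≡m))
  where
    u<w : u < w
    u<w = ℕP.≰⇒> w≰u
    w∸u≡m : w ∸ u ≡ m
    w∸u≡m = multiple<double⇒≡ (subst (m ℕ.∣_) (ℤP.∣⊖∣-< u<w) m∣u⊖w)
              (ℕP.m<n⇒0<n∸m u<w) (ℕP.≤-<-trans (ℕP.m∸n≤m w u) w<2m)

i≡[i-j]+j : ∀ i j → i ≡ (i - j) ℤ.+ j
i≡[i-j]+j = ℤ-Solver.solve-∀

[i-j]-k≡i-[j+k] : ∀ i j k → (i - j) - k ≡ i - (j ℤ.+ k)
[i-j]-k≡i-[j+k] = ℤ-Solver.solve-∀

[u-v]-r≡u⊖[v+r] : ∀ u v r → (+ u - + v) - + r ≡ u ⊖ (v + r)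
[u-v]-r≡u⊖[v+r] u v r = begin
  (+ u - + v) - + r   ≡⟨ [i-j]-k≡i-[j+k] (+ u) (+ v) (+ r) ⟩
  + u - (+ v ℤ.+ + r) ≡⟨ cong (λ k → + u - k) (ℤP.pos-+ v r) ⟨
  + u - + (v + r)     ≡⟨ ℤP.m-n≡m⊖n u (v + r) ⟩
  u ⊖ (v + r)         ∎
  where open ≡-Reasoning

pos-[r+t*m] : ∀ r t m → + (r + t * m) ≡ + r ℤ.+ + m ℤ.* + t
pos-[r+t*m] r t m = begin
  + (r + t * m)         ≡⟨ cong (λ k → + (r + k)) (ℕP.*-comm t m) ⟩
  + (r + m * t)         ≡⟨ ℤP.pos-+ r (m * t) ⟩
  + r ℤ.+ + (m * t)     ≡⟨ cong (λ k → + r ℤ.+ k) (ℤP.pos-* m t) ⟩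
  + r ℤ.+ + m ℤ.* + t   ∎
  where open ≡-Reasoning

[-m+r]+m[1+t]≡r+mt : ∀ m r t → (ℤ.- m ℤ.+ r) ℤ.+ m ℤ.* (ℤ.1ℤ ℤ.+ t) ≡ r ℤ.+ m ℤ.* t
[-m+r]+m[1+t]≡r+mt = ℤ-Solver.solve-∀

r+t*m≤m*v⇒t≤v : ∀ {m} .{{_ : NonZero m}} r t v → r + t * m ≤ m * v → t ≤ v
r+t*m≤m*v⇒t≤v {m} r t v r+tm≤mv = ℕP.*-cancelʳ-≤ t v m (begin
  t * m     ≤⟨ ℕP.m≤n+m (t * m) r ⟩
  r + t * m ≤⟨ r+tm≤mv ⟩
  m * v     ≡⟨ ℕP.*-comm m v ⟩
  v * m     ∎)
  where open ≤-Reasoning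

1+r+t*m≤m*v⇒t<v : ∀ {m} .{{_ : NonZero m}} r t v → suc r + t * m ≤ m * v → t < v
1+r+t*m≤m*v⇒t<v {m} r t v r+tm≤mv = ℕP.*-cancelʳ-< m t v (begin-strict
  t * m         <⟨ s≤s (ℕP.m≤n+m (t * m) r) ⟩
  suc r + t * m ≤⟨ r+tm≤mv ⟩
  m * v         ≡⟨ ℕP.*-comm m v ⟩
  v * m         ∎)
  where open ≤-Reasoning

module PerfectDifferenceSet
  (q : ℕ) (a : Fin (suc q) → ℤ)
  (a-bounded : ∀ i → (+ 1 ℤ.≤ a i) × (a i ℤ.≤ + (q * q + q + 1)))
  (σ : Σ (Fin (suc q) × Fin (suc q)) (λ p → proj₁ p ≢ proj₂ p) ⤖ Fin (q * q + q))
  (a-differences : ∀ p → (+ (q * q + q + 1)) ∣ ((a (proj₁ (proj₁ p)) - a (proj₂ (proj₁ p)))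
                     - + (suc (toℕ (Bijection.to σ p)))))
  where

  M : ℕ
  M = q * q + q + 1

  instance
    M-nonZero : NonZero M
    M-nonZero = >-nonZero (ℕP.m≤n+m 1 (q * q + q))

  aℕ : Fin (suc q) → ℕ
  aℕ i = ℤ.∣ a i ∣

  a≡+aℕ : ∀ i → a i ≡ + aℕ i
  a≡+aℕ i = sym (ℤP.0≤i⇒+∣i∣≡i (ℤP.≤-trans (ℤ.+≤+ z≤n) (proj₁ (a-bounded i))))

  aℕ≤M : ∀ i → aℕ i ≤ M
  aℕ≤M i = ℤP.drop‿+≤+ (subst (ℤ._≤ + M) (a≡+aℕ i) (proj₂ (a-bounded i)))

  -- Since 1 ≤ a i ≤ M, a difference congruent to r lies in (-M, M), so it is r or r - M.
  residue-difference : ∀ r → suc r < M →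
    ∃₂ λ i j → a i - a j ≡ + suc r ⊎ a i - a j ≡ ℤ.- + M ℤ.+ + suc r
  residue-difference r 1+r<M = i , j , Sum.map difference difference
    (bounded-⊖-multiple M∣ (aℕ≤M i) (ℕP.≤-trans (s≤s z≤n) (ℕP.m≤n+m (suc r) (aℕ j)))
                                    (ℕP.+-mono-≤-< (aℕ≤M j) 1+r<M))
    where
      r<q²+q : r < q * q + q
      r<q²+q = ℕP.≤-pred (subst (suc r <_) (ℕP.+-comm (q * q + q) 1) 1+r<M)
      p,σp≡r : ∃ λ p → Bijection.to σ p ≡ fromℕ< r<q²+q
      p,σp≡r = Bijection.strictlySurjective σ (fromℕ< r<q²+q)
      p : Σ (Fin (suc q) × Fin (suc q)) (λ p → proj₁ p ≢ proj₂ p)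
      p = proj₁ p,σp≡r
      i j : Fin (suc q)
      i = proj₁ (proj₁ p)
      j = proj₂ (proj₁ p)
      σp≡r : toℕ (Bijection.to σ p) ≡ r
      σp≡r = trans (cong toℕ (proj₂ p,σp≡r)) (toℕ-fromℕ< r<q²+q)
      δ-r≡⊖ : (a i - a j) - + suc r ≡ aℕ i ⊖ (aℕ j + suc r)
      δ-r≡⊖ = trans (cong₂ (λ α β → (α - β) - + suc r) (a≡+aℕ i) (a≡+aℕ j))
                    ([u-v]-r≡u⊖[v+r] (aℕ i) (aℕ j) (suc r))
      M∣ : + M ∣ aℕ i ⊖ (aℕ j + suc r)
      M∣ = subst (+ M ∣_) (trans (cong (λ k → (a i - a j) - + suc k) σp≡r) δ-r≡⊖) (a-differences p)
      difference : ∀ {ε} → aℕ i ⊖ (aℕ j + suc r) ≡ ε → a i - a j ≡ ε ℤ.+ + suc r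
      difference ⊖≡ε = trans (i≡[i-j]+j (a i - a j) (+ suc r)) (cong (ℤ._+ + suc r) (trans δ-r≡⊖ ⊖≡ε))

  Covered : ℕ → ℕ → Set
  Covered v x = ∃₂ λ i j → ∃ λ d → d ≤ v × (a i - a j) ℤ.+ + M ℤ.* + d ≡ + x

  covered : ∀ v r t → r < M → r + t * M ≤ M * v → Covered v (r + t * M)
  covered v zero t _ tM≤Mv = Fin.zero , Fin.zero , t , r+t*m≤m*v⇒t≤v 0 t v tM≤Mv , shifted
    where
      open ≡-Reasoning
      shifted : (a Fin.zero - a Fin.zero) ℤ.+ + M ℤ.* + t ≡ + (0 + t * M)
      shifted = begin
        (a Fin.zero - a Fin.zero) ℤ.+ + M ℤ.* + t ≡⟨ cong (λ δ → δ ℤ.+ + M ℤ.* + t) (ℤP.+-inverseʳ (a Fin.zero)) ⟩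
        + 0 ℤ.+ + M ℤ.* + t                       ≡⟨ pos-[r+t*m] 0 t M ⟨
        + (0 + t * M)                             ∎
  covered v (suc r) t 1+r<M x≤Mv with residue-difference r 1+r<M
  ... | i , j , inj₁ δ≡1+r = i , j , t , r+t*m≤m*v⇒t≤v (suc r) t v x≤Mv , shifted
    where
      open ≡-Reasoning
      shifted : (a i - a j) ℤ.+ + M ℤ.* + t ≡ + (suc r + t * M)
      shifted = begin
        (a i - a j) ℤ.+ + M ℤ.* + t ≡⟨ cong (λ δ → δ ℤ.+ + M ℤ.* + t) δ≡1+r ⟩
        + suc r ℤ.+ + M ℤ.* + t     ≡⟨ pos-[r+t*m] (suc r) t M ⟨
        + (suc r + t * M)           ∎
  ... | i , j , inj₂ δ≡1+r-M = i , j , suc t , 1+r+t*m≤m*v⇒t<v r t v x≤Mv , shifted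
    where
      open ≡-Reasoning
      shifted : (a i - a j) ℤ.+ + M ℤ.* + suc t ≡ + (suc r + t * M)
      shifted = begin
        (a i - a j) ℤ.+ + M ℤ.* + suc t           ≡⟨ cong (λ δ → δ ℤ.+ + M ℤ.* + suc t) δ≡1+r-M ⟩
        (ℤ.- + M ℤ.+ + suc r) ℤ.+ + M ℤ.* + suc t ≡⟨ [-m+r]+m[1+t]≡r+mt (+ M) (+ suc r) (+ t) ⟩
        + suc r ℤ.+ + M ℤ.* + t                   ≡⟨ pos-[r+t*m] (suc r) t M ⟨
        + (suc r + t * M)                         ∎

  covering : ∀ v x → x ≤ M * v → Covered v x
  covering v x x≤Mv =
    subst (Covered v) (sym x≡r+tM) (covered v (x % M) (x / M) (m%n<n x M) (subst (_≤ M * v) x≡r+tM x≤Mv))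
    where
      x≡r+tM : x ≡ x % M + (x / M) * M
      x≡r+tM = m≡m%n+[m/n]*n x M

lemma4 : (g v q : ℕ) → 1 ≤ g → 1 ≤ v → Prime q →
         (a : Fin (suc q) → ℤ) →
         (∀ i → (+ 1 ℤ.≤ a i) × (a i ℤ.≤ + (q * q + q + 1))) →
         (σ : Σ (Fin (suc q) × Fin (suc q)) (λ p → proj₁ p ≢ proj₂ p) ⤖ Fin (q * q + q)) →
         (∀ p → (+ (q * q + q + 1)) ∣ ((a (proj₁ (proj₁ p)) - a (proj₂ (proj₁ p)))
                   - + (suc (toℕ (Bijection.to σ p))))) →
         (B : List ℤ) → IsMinDiffBasis g v B →
         IsDiffBasis g ((q * q + q + 1) * v) (sumSet (q * q + q + 1) a B)
lemma4 g v q _ 1≤v _ a a-bounded σ a-differences B (basis , _) =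
  UniqueDec.deduplicate-! ℤ._≟_ _ , represented
  where
    open PerfectDifferenceSet q a a-bounded σ a-differences
    represented : ∀ x → 1 ≤ x → x ≤ M * v → g ≤ pairCount (sumSet M a B) (+ x)
    represented x _ x≤Mv with covering v x x≤Mv
    ... | i , j , d , d≤v , shifted≡x = begin
      g                                                      ≤⟨ IsDiffBasis⇒pairCount≥ basis 1≤v d d≤v ⟩
      pairCount B (+ d)                                      ≤⟨ pairCount-sumSet a (proj₁ basis) i j (+ d) ⟩
      pairCount (sumSet M a B) ((a i - a j) ℤ.+ + M ℤ.* + d) ≡⟨ cong (pairCount (sumSet M a B)) shifted≡x ⟩
      pairCount (sumSet M a B) (+ x)                         ∎
      where open ≤-Reasoning
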